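{- Assume the set of critical numbers is nonempty and $l_1>l'_1$. Then $\lambda$ is dominant ($\lambda_1\ge\lambda_2\ge\dots\ge\lambda_m$) and satisfies $\lambda_j+\lambda_{m+1-j}=w'+n-m-1$ for all $j\ne\frac{m+1}{2}$. In the case $n\equiv m\equiv1\bmod2$ one has $2\lambda_{\frac{m+1}{2}}=w'+n-m-2$, whereas in the case that $n,m$ are not both odd the identity $\lambda_j+\lambda_{m+1-j}=w'+n-m-1$ holds for all $j$.
   Context: For $N\ge1$ let $L_0^+(N)$ be the set of $(w,l)\in\mathbb{Z}\times\mathbb{Z}^N$ with $l_1>\dots>l_N$, $l_i+l_{N+1-i}=0$ and $w+l_i\equiv N+1\bmod2$. Fix $n,m\ge1$, $(w,l)\in L_0^+(n)$, $(w',l')\in L_0^+(m)$, $\delta,\delta'\in\{0,1\}$. In Knapp's notation for $W_{\mathbb{R}}$, $(l,t)$ ($l\ge1$) is irreducible $2$-dimensional and $(\mathrm{sgn}^\epsilon,t)$ is $1$-dimensional, $L(s,(l,t))=\Gamma_{\mathbb{C}}(s+t+\frac l2)$, $L(s,(\mathrm{sgn}^\epsilon,t))=\Gamma_{\mathbb{R}}(s+t+\epsilon)$, $\Gamma_{\mathbb{R}}(s)=\pi^{ -s/2}\Gamma(s/2)$, $\Gamma_{\mathbb{C}}(s)=2(2\pi)^{ -s}\Gamma(s)$; multiplicative over constituents. $\pi_\infty^W=\bigoplus_{i\le n/2}(l_i,-w/2)$ plus $(\mathrm{sgn}^\delta,-w/2)$ if $n$ odd; $\sigma_\infty^W$ analogously;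 $\tau=\pi_\infty^W\otimes\sigma_\infty^W$. $t\in\frac{n+m}{2}+\mathbb{Z}$ is critical if neither $L(s,\tau)$ nor $L(1-s,\check\tau)$ has a pole at $s=t$. Highest weight $\nu\in\mathbb{Z}^m$: $\nu_j=\frac{w'+l'_j+2j-1-m}{2}$ (so $\nu_1\ge\dots\ge\nu_m$, $\nu_j+\nu_{m+1-j}=w'$). Position tuple: $a_j$ is the unique integer with $1\le a_j\le n-1$ and $l_{a_j}>l'_j\ge l_{1+a_j}$. Define $\lambda\in\mathbb{Z}^m$ by $\lambda_j=\nu_j+a_j-j$. -}

module Defs where

open import Data.Nat as ℕ using (ℕ; zero; suc; _∸_; _≡ᵇ_)
import Data.Nat.DivMod as ℕD
open import Data.Integer as ℤ using (ℤ; +_; -_; _+_; _-_; _*_; ∣_∣; 0ℤ)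
open import Data.Integer.DivMod using (_/ℕ_)
open import Data.Integer.Divisibility using (_∣_)
open import Data.Bool using (if_then_else_)
open import Data.List using (List; []; _∷_; _++_; map; upTo; concatMap)
open import Data.List.Relation.Unary.Any using (Any)
open import Data.Product using (_×_; ∃)
open import Relation.Binary.PropositionalEquality using (_≡_)
open import Relation.Nullary using (¬_)

-- Sequences l₁,…,l_N are encoded as functions ℕ → ℤ, only the values
-- at indices 1 … N matter (1-based, as in the paper).
-- Half-integers (t, s, 2-dim/1-dim parameters t of Knapp) are encoded
-- by their DOUBLE, an integer: "T" stands for 2t.

InL0+ : ℕ → ℤ → (ℕ → ℤ) → Set
InL0+ N w l =
    (∀ i → 1 ℕ.≤ i → i ℕ.< N → l (suc i) ℤ.< l i)
  × (∀ i → 1 ℕ.≤ i → i ℕ.≤ N → l i + l (suc N ∸ i) ≡ 0ℤ)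
  × (∀ i → 1 ℕ.≤ i → i ℕ.≤ N → (+ 2) ∣ (w + l i - + (suc N)))

-- Irreducible representations of W_ℝ (Knapp's notation), with doubled t:
--   cplx l T  =  (l , T/2)          (l ≥ 1, two-dimensional)
--   real ε T  =  (sgn^ε , T/2)      (ε ∈ {0,1}, one-dimensional)
data WR : Set where
  cplx : ℕ → ℤ → WR
  real : ℕ → ℤ → WR

-- Γ_ℂ(z) = 2(2π)^{-z} Γ(z) has a pole at z = Z/2 iff z ∈ {0,-1,-2,…}
ΓℂPole : ℤ → Set
ΓℂPole Z = ∃ λ (k : ℕ) → Z ≡ - (+ (2 ℕ.* k))

-- Γ_ℝ(z) = π^{-z/2} Γ(z/2) has a pole at z = Z/2 iff z ∈ {0,-2,-4,…}
ΓℝPole : ℤ → Set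
ΓℝPole Z = ∃ λ (k : ℕ) → Z ≡ - (+ (4 ℕ.* k))

-- L(s, ρ) has a pole at s = S/2:
--   L(s,(l,t)) = Γ_ℂ(s + t + l/2),  L(s,(sgn^ε,t)) = Γ_ℝ(s + t + ε)
LPole : WR → ℤ → Set
LPole (cplx l T) S = ΓℂPole (S + T + + l)
LPole (real ε T) S = ΓℝPole (S + T + + (2 ℕ.* ε))

-- L is multiplicative over constituents; Γ has no zeros, so the poles of
-- L(s, ⊕ρᵢ) are the union of the poles of the L(s,ρᵢ).
LPoleSum : List WR → ℤ → Set
LPoleSum τ S = Any (λ ρ → LPole ρ S) τ

dual : WR → WR
dual (cplx l T) = cplx l (- T)
dual (real ε T) = real ε (- T)

-- Tensor product of irreducibles of W_ℝ (Knapp):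
--  (l,t)⊗(l',t') = (l+l',t+t') ⊕ (|l-l'|,t+t')            if l ≠ l'
--  (l,t)⊗(l,t')  = (2l,t+t') ⊕ (sgn^0,t+t') ⊕ (sgn^1,t+t')
--  (l,t)⊗(sgn^ε,t') = (l,t+t')
--  (sgn^ε,t)⊗(sgn^ε',t') = (sgn^{ε+ε'},t+t')
tensorIrr : WR → WR → List WR
tensorIrr (cplx l T) (cplx l' T') =
  if l ≡ᵇ l'
  then cplx (l ℕ.+ l') (T + T') ∷ real 0 (T + T') ∷ real 1 (T + T') ∷ []
  else cplx (l ℕ.+ l') (T + T') ∷ cplx ∣ + l - + l' ∣ (T + T') ∷ []
tensorIrr (cplx l T) (real ε' T') = cplx l (T + T') ∷ []
tensorIrr (real ε T) (cplx l' T') = cplx l' (T + T') ∷ []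
tensorIrr (real ε T) (real ε' T') = real ((ε ℕ.+ ε') ℕD.% 2) (T + T') ∷ []

tensor : List WR → List WR → List WR
tensor π σ = concatMap (λ ρ → concatMap (tensorIrr ρ) σ) π

-- π_∞^W = ⊕_{i ≤ N/2} (l_i , -w/2)  ⊕  (sgn^δ , -w/2) if N odd
parW : ℕ → ℤ → (ℕ → ℤ) → ℕ → List WR
parW N w l δ =
  map (λ i → cplx ∣ l (suc i) ∣ (- w)) (upTo (N ℕD./ 2))
  ++ (if (N ℕD.% 2) ≡ᵇ 1 then real δ (- w) ∷ [] else [])

tauW : ℕ → ℤ → (ℕ → ℤ) → ℕ → ℕ → ℤ → (ℕ → ℤ) → ℕ → List WR
tauW n w l δ m w' l' δ' = tensor (parW n w l δ) (parW m w' l' δ')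

-- t = T/2 is critical: t ∈ (n+m)/2 + ℤ, L(s,τ) has no pole at s = t and
-- L(1-s, τ̌) has no pole at s = t  (1 - t has double 2 - T)
Critical : ℕ → ℕ → List WR → ℤ → Set
Critical n m τ T =
    (+ 2) ∣ (T - + (n ℕ.+ m))
  × ¬ LPoleSum τ T
  × ¬ LPoleSum (map dual τ) (+ 2 - T)

-- highest weight ν_j = (w' + l'_j + 2j - 1 - m)/2  (exact division: the
-- numerator is even for (w',l') ∈ L₀⁺(m))
nu : ℕ → ℤ → (ℕ → ℤ) → ℕ → ℤ
nu m w' l' j = (w' + l' j + + (2 ℕ.* j) - + 1 - + m) /ℕ 2

IsPositionTuple : ℕ → (ℕ → ℤ) → ℕ → (ℕ → ℤ) → (ℕ → ℕ) → Set
IsPositionTuple n l m l' a =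
  ∀ j → 1 ℕ.≤ j → j ℕ.≤ m →
    1 ℕ.≤ a j × a j ℕ.≤ n ∸ 1 × l' j ℤ.< l (a j) × l (suc (a j)) ℤ.≤ l' j

lam : ℕ → ℤ → (ℕ → ℤ) → (ℕ → ℕ) → ℕ → ℤ
lam m w' l' a j = nu m w' l' j + + (a j) - + j

module Submission where

-- Write 2λ_j = w' + l'_j + 2a_j - m - 1 (the defining formula of ν is an exact
-- halving, by the parity condition in L₀⁺(m)).
--
-- * Dominance.  2λ_{j+1} - 2λ_j < 2 follows from l'_{j+1} < l'_j when
--   a_{j+1} ≤ a_j, and otherwise from l'_{j+1} < l_{a_{j+1}}, l_{a_j+1} ≤ l'_j and
--   the fact that i ↦ l_i + 2i is non-increasing (consecutive l_i differ by an
--   even positive amount).  Since λ is integral, λ_{j+1} ≤ λ_j.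
-- * Symmetry.  Mirroring l_i = -l_{n+1-i} and l'_j = -l'_{m+1-j} turns the
--   position a_{m+1-j} into a second bracket n - a_{m+1-j} around l'_j, which
--   agrees with a_j unless l'_j coincides with an entry l_{a_j+1}.  Criticality
--   excludes nonzero coincidences: l_i = l'_j = p > 0 puts (p,-w/2) into π and
--   (p,-w'/2) into σ, whose tensor product contains sgn⁰ and sgn¹ with a common
--   twist, and then some Γ_ℝ-factor of L(s,τ) or L(1-s,τ̌) has a pole at every
--   admissible t.  A zero coincidence forces j and a_j + 1 to be the middle
--   indices, so n and m are odd, and then 2λ_{(m+1)/2} = w' + n - m - 2.

open import Defs
open import Data.Nat as ℕ using (ℕ; suc; _∸_; zero; z≤n; s≤s)
import Data.Nat.Properties as ℕP
open import Data.Nat.DivMod using (_%_; _/_; m*n/n≡m; /-monoˡ-≤; m≡m%n+[m/n]*n; [m+kn]%n≡m%n)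
open import Data.Nat.Divisibility using (n∣m⇒m%n≡0)
open import Data.Integer as ℤ using (ℤ; +_; -[1+_]; _+_; _-_; _*_; -_; 0ℤ; _/ℕ_; _%ℕ_)
import Data.Integer.Properties as ℤP
open import Data.Integer.DivMod using (a≡a%ℕn+[a/ℕn]*n)
open import Data.Integer.Divisibility using (_∣_)
import Data.Integer.Divisibility.Signed as Signed
open import Data.Integer.Tactic.RingSolver using (solve-∀)
open import Data.Product using (_×_; ∃; _,_; proj₁; proj₂)
open import Data.Sum using (_⊎_; inj₁; inj₂; [_,_]) renaming (map to ⊎-map)
open import Data.Empty using (⊥-elim)
open import Data.Bool using (true)
open import Data.List using (concatMap)
open import Data.List.Relation.Unary.Any using (here; there)
open import Data.List.Membership.Propositional using (_∈_; lose)
open import Data.List.Membership.Propositional.Properties using (∈-map⁺; ∈-concatMap⁺; ∈-upTo⁺; ∈-++⁺ˡ)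
open import Relation.Binary.Definitions using (Reflexive; Transitive; tri<; tri≈; tri>)
open import Relation.Binary.PropositionalEquality
  using (_≡_; _≢_; refl; sym; trans; cong; cong₂; subst; subst₂; module ≡-Reasoning)
open import Relation.Nullary using (¬_; yes; no)

-- The remainder of an even integer by 2 vanishes (for negative x, _%ℕ_ is
-- computed from the remainder of |x|).
even⇒%ℕ2≡0 : ∀ x → + 2 ∣ x → x %ℕ 2 ≡ 0
even⇒%ℕ2≡0 (+ n)    2∣x = n∣m⇒m%n≡0 n 2 2∣x
even⇒%ℕ2≡0 -[1+ n ] 2∣x with suc n % 2 | n∣m⇒m%n≡0 (suc n) 2 2∣x
... | zero  | _  = refl
... | suc _ | ()

twice-half : ∀ x → + 2 ∣ x → + 2 * (x /ℕ 2) ≡ x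
twice-half x 2∣x = begin
  + 2 * (x /ℕ 2)                ≡⟨ ℤP.*-comm (+ 2) (x /ℕ 2) ⟩
  (x /ℕ 2) * + 2                ≡⟨ ℤP.+-identityˡ _ ⟨
  + 0 + (x /ℕ 2) * + 2          ≡⟨ cong (λ r → + r + (x /ℕ 2) * + 2) (even⇒%ℕ2≡0 x 2∣x) ⟨
  + (x %ℕ 2) + (x /ℕ 2) * + 2   ≡⟨ a≡a%ℕn+[a/ℕn]*n x 2 ⟨
  x                             ∎
  where open ≡-Reasoning

even-gap : ∀ {x y} → + 2 Signed.∣ (x - y) → y ℤ.< x → y + + 2 ℤ.≤ x
even-gap {x} {y} (Signed.divides (+ zero) eq) y<x =
  ⊥-elim (ℤP.<-irrefl (sym (ℤP.i-j≡0⇒i≡j x y eq)) y<x)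
even-gap {x} {y} (Signed.divides (+ suc k) eq) y<x = begin
  y + + 2        ≤⟨ ℤP.+-monoʳ-≤ y (subst (+ 2 ℤ.≤_) (sym eq) (ℤ.+≤+ (s≤s (s≤s z≤n)))) ⟩
  y + (x - y)    ≡⟨ cancel x y ⟩
  x              ∎
  where
  open ℤP.≤-Reasoning
  cancel : ∀ x y → y + (x - y) ≡ x
  cancel = solve-∀
even-gap {x} {y} (Signed.divides -[1+ k ] eq) y<x =
  ⊥-elim (ℤP.<⇒≱ y<x (ℤP.i-j≤0⇒i≤j (subst (ℤ._≤ 0ℤ) (sym eq) ℤ.-≤+)))

twice : ∀ k → 2 ℕ.* k ≡ k ℕ.+ k
twice k = cong (k ℕ.+_) (ℕP.+-identityʳ k)

parity : ∀ p → ∃ λ k → p ≡ k ℕ.+ k ⊎ p ≡ suc (k ℕ.+ k)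
parity zero = 0 , inj₁ refl
parity (suc p) with parity p
... | k , inj₁ refl = k , inj₂ refl
... | k , inj₂ refl = suc k , inj₁ (cong suc (sym (ℕP.+-suc k k)))

odd⇒suc-twice : ∀ {N} → N % 2 ≡ 1 → N ≡ suc (2 ℕ.* (N / 2))
odd⇒suc-twice {N} odd = trans (m≡m%n+[m/n]*n N 2) (cong₂ ℕ._+_ odd (ℕP.*-comm (N / 2) 2))

odd⇒≢twice : ∀ {N} k → N % 2 ≡ 1 → k ℕ.+ k ≢ N
odd⇒≢twice {N} k odd k+k≡N = ℕP.even≢odd k (N / 2) (trans (twice k) (trans k+k≡N (odd⇒suc-twice odd)))

twice≡suc⇒odd : ∀ {N} k → 2 ℕ.* k ≡ suc N → N % 2 ≡ 1
twice≡suc⇒odd {N} (suc k) 2k≡N+1 = begin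
  N % 2                ≡⟨ cong (_% 2) N≡1+k*2 ⟩
  (1 ℕ.+ k ℕ.* 2) % 2  ≡⟨ [m+kn]%n≡m%n 1 k 2 ⟩
  1                    ∎
  where
  open ≡-Reasoning
  N≡1+k*2 : N ≡ 1 ℕ.+ k ℕ.* 2
  N≡1+k*2 = trans (sym (ℕP.suc-injective (trans (sym (ℕP.*-suc 2 k)) 2k≡N+1)))
                  (cong suc (ℕP.*-comm 2 k))

odd⇒middle : ∀ {N} → N % 2 ≡ 1 → 2 ℕ.* (suc N / 2) ≡ suc N
odd⇒middle {N} odd = begin
  2 ℕ.* (suc N / 2)       ≡⟨ cong (λ M → 2 ℕ.* (suc M / 2)) N≡1+h*2 ⟩
  2 ℕ.* (suc h ℕ.* 2 / 2) ≡⟨ cong (2 ℕ.*_) (m*n/n≡m (suc h) 2) ⟩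
  2 ℕ.* suc h             ≡⟨ ℕP.*-comm 2 (suc h) ⟩
  suc h ℕ.* 2             ≡⟨ cong suc N≡1+h*2 ⟨
  suc N                   ∎
  where
  open ≡-Reasoning
  h = N / 2
  N≡1+h*2 : N ≡ 1 ℕ.+ h ℕ.* 2
  N≡1+h*2 = trans (m≡m%n+[m/n]*n N 2) (cong (ℕ._+ h ℕ.* 2) odd)

middle-range : ∀ {N} k → 2 ℕ.* k ≡ suc N → 1 ℕ.≤ k × k ℕ.≤ N
middle-range {N} (suc k) 2k≡N+1 =
  s≤s z≤n , subst (suc k ℕ.≤_) (ℕP.suc-injective (trans (sym (twice (suc k))) 2k≡N+1)) (ℕP.m≤n+m (suc k) k)

middle-mirror : ∀ {N} k → 2 ℕ.* k ≡ suc N → suc N ∸ k ≡ k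
middle-mirror {N} k 2k≡N+1 = trans (cong (_∸ k) (trans (sym 2k≡N+1) (twice k))) (ℕP.m+n∸n≡m k k)

-- a ≤ n - 1 with a ≥ 1 means a + 1 ≤ n (truncated subtraction needs n ≥ 1).
below-pred : ∀ {a n} → 1 ℕ.≤ a → a ℕ.≤ n ∸ 1 → suc a ℕ.≤ n
below-pred {n = suc n} _       a≤n = s≤s a≤n
below-pred {n = zero}  (s≤s _) ()

chain : ∀ {A : Set} (R : A → A → Set) → Transitive R → (g : ℕ → A) (N : ℕ) →
        (∀ i → 1 ℕ.≤ i → i ℕ.< N → R (g (suc i)) (g i)) →
        ∀ {i j} → 1 ℕ.≤ i → i ℕ.< j → j ℕ.≤ N → R (g j) (g i)
chain R R-trans g N step {i} {suc j} 1≤i (s≤s i≤j) j<N with ℕP.m≤n⇒m<n∨m≡n i≤j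
... | inj₁ i<j  = R-trans (step j (ℕP.≤-trans 1≤i i≤j) j<N) (chain R R-trans g N step 1≤i i<j (ℕP.<⇒≤ j<N))
... | inj₂ refl = step i 1≤i j<N

chain-refl : ∀ {A : Set} (R : A → A → Set) → Reflexive R → Transitive R → (g : ℕ → A) (N : ℕ) →
             (∀ i → 1 ℕ.≤ i → i ℕ.< N → R (g (suc i)) (g i)) →
             ∀ {i j} → 1 ℕ.≤ i → i ℕ.≤ j → j ℕ.≤ N → R (g j) (g i)
chain-refl R R-refl R-trans g N step 1≤i i≤j j≤N with ℕP.m≤n⇒m<n∨m≡n i≤j
... | inj₁ i<j  = chain R R-trans g N step 1≤i i<j j≤N
... | inj₂ refl = R-refl

module L0⁺ {N : ℕ} {w : ℤ} {f : ℕ → ℤ} (H : InL0+ N w f) where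

  decreasing : ∀ {i j} → 1 ℕ.≤ i → i ℕ.< j → j ℕ.≤ N → f j ℤ.< f i
  decreasing = chain ℤ._<_ ℤP.<-trans f N (proj₁ H)

  antitone : ∀ {i j} → 1 ℕ.≤ i → i ℕ.≤ j → j ℕ.≤ N → f j ℤ.≤ f i
  antitone = chain-refl ℤ._≤_ ℤP.≤-refl ℤP.≤-trans f N (λ i 1≤i i<N → ℤP.<⇒≤ (proj₁ H i 1≤i i<N))

  -- All w + f_i - (N + 1) are even, so consecutive entries differ by at least 2.
  gap : ∀ i → 1 ℕ.≤ i → i ℕ.< N → f (suc i) + + 2 ℤ.≤ f i
  gap i 1≤i i<N = even-gap (subst (+ 2 Signed.∣_) (difference w (f i) (f (suc i)) (+ suc N))
                             (Signed.∣m∣n⇒∣m-n (even i 1≤i (ℕP.<⇒≤ i<N)) (even (suc i) (s≤s z≤n) i<N)))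
                           (proj₁ H i 1≤i i<N)
    where
    even : ∀ i → 1 ℕ.≤ i → i ℕ.≤ N → + 2 Signed.∣ (w + f i - + suc N)
    even i 1≤i i≤N = Signed.∣ᵤ⇒∣ (proj₂ (proj₂ H) i 1≤i i≤N)
    difference : ∀ w a b c → (w + a - c) - (w + b - c) ≡ a - b
    difference = solve-∀

  shiftedAntitone : ∀ {i j} → 1 ℕ.≤ i → i ℕ.≤ j → j ℕ.≤ N → f j + + 2 * + j ℤ.≤ f i + + 2 * + i
  shiftedAntitone = chain-refl ℤ._≤_ ℤP.≤-refl ℤP.≤-trans (λ i → f i + + 2 * + i) N step
    where
    shift : ∀ x I → x + + 2 * (+ 1 + I) ≡ (x + + 2) + + 2 * I
    shift = solve-∀
    step : ∀ i → 1 ℕ.≤ i → i ℕ.< N → f (suc i) + + 2 * + suc i ℤ.≤ f i + + 2 * + i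
    step i 1≤i i<N = subst (ℤ._≤ f i + + 2 * + i) (sym (shift (f (suc i)) (+ i)))
                           (ℤP.+-monoˡ-≤ (+ 2 * + i) (gap i 1≤i i<N))

  ≤-reflect : ∀ {i j} → 1 ℕ.≤ i → i ℕ.≤ N → 1 ℕ.≤ j → f j ℤ.≤ f i → i ℕ.≤ j
  ≤-reflect {i} {j} 1≤i i≤N 1≤j fj≤fi with j ℕP.<? i
  ... | yes j<i = ⊥-elim (ℤP.<⇒≱ (decreasing 1≤j j<i i≤N) fj≤fi)
  ... | no  j≮i = ℕP.≮⇒≥ j≮i

  injective : ∀ {i j} → 1 ℕ.≤ i → i ℕ.≤ N → 1 ℕ.≤ j → j ℕ.≤ N → f i ≡ f j → i ≡ j
  injective 1≤i i≤N 1≤j j≤N fi≡fj =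
    ℕP.≤-antisym (≤-reflect 1≤i i≤N 1≤j (ℤP.≤-reflexive (sym fi≡fj)))
                 (≤-reflect 1≤j j≤N 1≤i (ℤP.≤-reflexive fi≡fj))

  mirror-range : ∀ {i} → 1 ℕ.≤ i → i ℕ.≤ N → 1 ℕ.≤ suc N ∸ i × suc N ∸ i ℕ.≤ N
  mirror-range {i} 1≤i i≤N = subst (1 ℕ.≤_) (sym (ℕP.+-∸-assoc 1 i≤N)) (s≤s z≤n) , ℕP.∸-monoʳ-≤ (suc N) 1≤i

  mirror : ∀ {i} → 1 ℕ.≤ i → i ℕ.≤ N → f (suc N ∸ i) ≡ - f i
  mirror {i} 1≤i i≤N = begin
    f (suc N ∸ i)                 ≡⟨ cancel (f i) (f (suc N ∸ i)) ⟩
    (f i + f (suc N ∸ i)) - f i   ≡⟨ cong (_- f i) (proj₁ (proj₂ H) i 1≤i i≤N) ⟩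
    0ℤ - f i                      ≡⟨ ℤP.+-identityˡ (- f i) ⟩
    - f i                         ∎
    where
    open ≡-Reasoning
    cancel : ∀ a b → b ≡ (a + b) - a
    cancel = solve-∀

  positive⇒firstHalf : ∀ {i} → 1 ℕ.≤ i → i ℕ.≤ N → 0ℤ ℤ.< f i → 2 ℕ.* i ℕ.≤ N
  positive⇒firstHalf {i} 1≤i i≤N 0<fi with 2 ℕ.* i ℕP.≤? N
  ... | yes 2i≤N = 2i≤N
  ... | no  2i≰N = ⊥-elim (ℤP.<-asym 0<fi (ℤP.≤-<-trans fi≤-fi (ℤP.neg-mono-< 0<fi)))
    where
    i'≤i : suc N ∸ i ℕ.≤ i
    i'≤i = ℕP.m≤n+o⇒m∸n≤o (suc N) i (subst (suc N ℕ.≤_) (twice i) (ℕP.≰⇒> 2i≰N))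
    fi≤-fi : f i ℤ.≤ - f i
    fi≤-fi = subst (f i ℤ.≤_) (mirror 1≤i i≤N) (antitone (proj₁ (mirror-range 1≤i i≤N)) i'≤i i≤N)

  zero⇒middle : ∀ {i} → 1 ℕ.≤ i → i ℕ.≤ N → f i ≡ 0ℤ → 2 ℕ.* i ≡ suc N
  zero⇒middle {i} 1≤i i≤N fi≡0 = begin
    2 ℕ.* i              ≡⟨ twice i ⟩
    i ℕ.+ i              ≡⟨ cong (ℕ._+ i) i'≡i ⟨
    (suc N ∸ i) ℕ.+ i    ≡⟨ ℕP.m∸n+n≡m (ℕP.m≤n⇒m≤1+n i≤N) ⟩
    suc N                ∎
    where
    open ≡-Reasoning
    i'≡i : suc N ∸ i ≡ i
    i'≡i = injective (proj₁ (mirror-range 1≤i i≤N)) (proj₂ (mirror-range 1≤i i≤N)) 1≤i i≤N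
                     (trans (mirror 1≤i i≤N) (trans (cong -_ fi≡0) (sym fi≡0)))

  middle⇒zero : ∀ {i} → 1 ℕ.≤ i → i ℕ.≤ N → 2 ℕ.* i ≡ suc N → f i ≡ 0ℤ
  middle⇒zero {i} 1≤i i≤N 2i≡N+1 = ℤP.*-cancelˡ-≡ (+ 2) (f i) 0ℤ (trans (double (f i)) fi+fi≡0)
    where
    double : ∀ x → + 2 * x ≡ x + x
    double = solve-∀
    fi+fi≡0 : f i + f i ≡ 0ℤ
    fi+fi≡0 = subst (λ k → f i + f k ≡ 0ℤ) (middle-mirror i 2i≡N+1) (proj₁ (proj₂ H) i 1≤i i≤N)

  bracket : ∀ {x p q} → 1 ℕ.≤ p → suc p ℕ.≤ N → 1 ℕ.≤ q → suc q ℕ.≤ N →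
            f (suc p) ℤ.≤ x → x ℤ.< f p → f (suc q) ℤ.< x → x ℤ.≤ f q →
            p ≡ q ⊎ x ≡ f (suc p)
  bracket {x} {p} {q} 1≤p p<N 1≤q q<N fp'≤x x<fp fq'<x x≤fq with ℕP.<-cmp p q
  ... | tri< p<q _ _ = inj₂ (ℤP.≤-antisym (ℤP.≤-trans x≤fq (antitone (s≤s z≤n) p<q (ℕP.<⇒≤ q<N))) fp'≤x)
  ... | tri≈ _ p≡q _ = inj₁ p≡q
  ... | tri> _ _ q<p = ⊥-elim (ℤP.<-asym x<fp (ℤP.≤-<-trans (antitone (s≤s z≤n) q<p (ℕP.<⇒≤ p<N)) fq'<x))

-- Poles of τ

fourfold : ∀ k → - (+ 4 * + k) ≡ - + (4 ℕ.* k)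
fourfold k = cong -_ (sym (ℤP.pos-* 4 k))

-- For every integer z, one of Γ_ℝ(z), Γ_ℝ(z+1), Γ_ℝ(1-z), Γ_ℝ(2-z) has a pole
-- (arguments doubled, as in ΓℝPole): z ≤ 0 is caught by the first two,
-- z ≥ 1 by the last two, according to the parity of z.
integerPole : ∀ q → ΓℝPole (q * + 2) ⊎ ΓℝPole (q * + 2 + + 2) ⊎ ΓℝPole (+ 2 - q * + 2) ⊎ ΓℝPole (+ 4 - q * + 2)
integerPole (+ zero) = inj₁ (0 , refl)
integerPole (+ suc p) with parity p
... | k , inj₁ refl = inj₂ (inj₂ (inj₁ (k , trans (shape (+ k)) (fourfold k))))
  where shape : ∀ K → + 2 - (+ 1 + (K + K)) * + 2 ≡ - (+ 4 * K)
        shape = solve-∀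
... | k , inj₂ refl = inj₂ (inj₂ (inj₂ (k , trans (shape (+ k)) (fourfold k))))
  where shape : ∀ K → + 4 - (+ 1 + (+ 1 + (K + K))) * + 2 ≡ - (+ 4 * K)
        shape = solve-∀
integerPole -[1+ p ] with parity p
... | k , inj₁ refl = inj₂ (inj₁ (k , trans (shape (+ k)) (fourfold k)))
  where shape : ∀ K → - (+ 1 + (K + K)) * + 2 + + 2 ≡ - (+ 4 * K)
        shape = solve-∀
... | k , inj₂ refl = inj₁ (suc k , trans (shape (+ k)) (fourfold (suc k)))
  where shape : ∀ K → - (+ 1 + (+ 1 + (K + K))) * + 2 ≡ - (+ 4 * (+ 1 + K))
        shape = solve-∀

sgnPair-notCritical : ∀ {n m τ T S} → real 0 S ∈ τ → real 1 S ∈ τ → + 2 Signed.∣ (T + S) →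
                      ¬ Critical n m τ T
sgnPair-notCritical {τ = τ} {T} {S} sgn⁰∈τ sgn¹∈τ (Signed.divides q T+S≡2q) (_ , noPole , noDualPole)
  with integerPole q
... | inj₁ pole = noPole (lose sgn⁰∈τ (subst ΓℝPole (sym (trans (ℤP.+-identityʳ (T + S)) T+S≡2q)) pole))
... | inj₂ (inj₁ pole) = noPole (lose sgn¹∈τ (subst ΓℝPole (sym (cong (_+ + 2) T+S≡2q)) pole))
... | inj₂ (inj₂ (inj₁ pole)) =
  noDualPole (lose (∈-map⁺ dual sgn⁰∈τ) (subst ΓℝPole (sym (trans (dual⁰ T S) (cong (λ z → + 2 - z) T+S≡2q))) pole))
  where dual⁰ : ∀ T S → + 2 - T + - S + + 0 ≡ + 2 - (T + S)
        dual⁰ = solve-∀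
... | inj₂ (inj₂ (inj₂ pole)) =
  noDualPole (lose (∈-map⁺ dual sgn¹∈τ) (subst ΓℝPole (sym (trans (dual¹ T S) (cong (λ z → + 4 - z) T+S≡2q))) pole))
  where dual¹ : ∀ T S → + 2 - T + - S + + 2 ≡ + 4 - (T + S)
        dual¹ = solve-∀

sgn∈tensorIrr : ∀ p A B → real 0 (A + B) ∈ tensorIrr (cplx p A) (cplx p B)
                        × real 1 (A + B) ∈ tensorIrr (cplx p A) (cplx p B)
sgn∈tensorIrr p A B with p ℕ.≡ᵇ p | ℕP.≡⇒≡ᵇ p p refl
... | true | _ = there (here refl) , there (there (here refl))

∈-tensor : ∀ {ρ σ x π σs} → ρ ∈ π → σ ∈ σs → x ∈ tensorIrr ρ σ → x ∈ tensor π σs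
∈-tensor {ρ} {σs = σs} ρ∈π σ∈σs x∈ρ⊗σ =
  ∈-concatMap⁺ (λ ρ → concatMap (tensorIrr ρ) σs) (lose ρ∈π (∈-concatMap⁺ (tensorIrr ρ) (lose σ∈σs x∈ρ⊗σ)))

cplx∈parW : ∀ N w l δ {i} → suc i ℕ.≤ N / 2 → cplx ℤ.∣ l (suc i) ∣ (- w) ∈ parW N w l δ
cplx∈parW N w l δ i<N/2 = ∈-++⁺ˡ (∈-map⁺ _ (∈-upTo⁺ i<N/2))

≤half : ∀ {i N} → 2 ℕ.* i ℕ.≤ N → i ℕ.≤ N / 2
≤half {i} {N} 2i≤N = subst (ℕ._≤ N / 2) (m*n/n≡m i 2) (/-monoˡ-≤ 2 (subst (ℕ._≤ N) (ℕP.*-comm 2 i) 2i≤N))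

twist-parity : ∀ n m w w' x T → + 2 ∣ (w + x - + suc n) → + 2 ∣ (w' + x - + suc m) →
               + 2 ∣ (T - + (n ℕ.+ m)) → + 2 Signed.∣ (T + (- w + - w'))
twist-parity n m w w' x T even₁ even₂ evenT =
  subst (+ 2 Signed.∣_) (sym (decompose T w w' x (+ n) (+ m)))
    (Signed.∣m∣n⇒∣m+n (Signed.∣m∣n⇒∣m-n (Signed.∣m∣n⇒∣m-n (subst (+ 2 Signed.∣_) (cong (λ z → T - z) (ℤP.pos-+ n m))
                                                                                  (Signed.∣ᵤ⇒∣ evenT))
                                                          (Signed.∣ᵤ⇒∣ even₁))
                                        (Signed.∣ᵤ⇒∣ even₂))
                       (Signed.∣n⇒∣m*n (x - + 1) Signed.∣-refl))
  where
  decompose : ∀ T w w' x N M → T + (- w + - w')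
                              ≡ (T - (N + M)) - (w + x - (+ 1 + N)) - (w' + x - (+ 1 + M)) + (x - + 1) * + 2
  decompose = solve-∀

module Coincidence {n m δ δ' T} {w w' : ℤ} {l l' : ℕ → ℤ} (Hl : InL0+ n w l) (Hl' : InL0+ m w' l')
                   (crit : Critical n m (tauW n w l δ m w' l' δ') T) where
  private
    module S  = L0⁺ {n} {w} {l} Hl
    module S' = L0⁺ {m} {w'} {l'} Hl'

  no-positive-coincidence : ∀ {i j} → 1 ℕ.≤ i → i ℕ.≤ n → 1 ℕ.≤ j → j ℕ.≤ m → l i ≡ l' j → ¬ (0ℤ ℤ.< l' j)
  no-positive-coincidence {suc i} {suc j} _ i≤n _ j≤m li≡l'j 0<l'j =
    sgnPair-notCritical {n} {m} (∈-tensor π∋ σ∋ (proj₁ sgn)) (∈-tensor π∋ σ∋ (proj₂ sgn))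
      (twist-parity n m w w' (l (suc i)) T (proj₂ (proj₂ Hl) (suc i) (s≤s z≤n) i≤n) even' (proj₁ crit)) crit
    where
    sgn = sgn∈tensorIrr ℤ.∣ l (suc i) ∣ (- w) (- w')
    π∋ : cplx ℤ.∣ l (suc i) ∣ (- w) ∈ parW n w l δ
    π∋ = cplx∈parW n w l δ (≤half {N = n} (S.positive⇒firstHalf (s≤s z≤n) i≤n (subst (0ℤ ℤ.<_) (sym li≡l'j) 0<l'j)))
    σ∋ : cplx ℤ.∣ l (suc i) ∣ (- w') ∈ parW m w' l' δ'
    σ∋ = subst (λ x → cplx ℤ.∣ x ∣ (- w') ∈ parW m w' l' δ') (sym li≡l'j)
               (cplx∈parW m w' l' δ' (≤half {N = m} (S'.positive⇒firstHalf (s≤s z≤n) j≤m 0<l'j)))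
    even' : + 2 ∣ (w' + l (suc i) - + suc m)
    even' = subst (λ x → + 2 ∣ (w' + x - + suc m)) (sym li≡l'j) (proj₂ (proj₂ Hl') (suc j) (s≤s z≤n) j≤m)

  -- A negative coincidence is a positive one at the mirrored indices.
  coincidence⇒zero : ∀ {i j} → 1 ℕ.≤ i → i ℕ.≤ n → 1 ℕ.≤ j → j ℕ.≤ m → l i ≡ l' j → l' j ≡ 0ℤ
  coincidence⇒zero {i} {j} 1≤i i≤n 1≤j j≤m li≡l'j with ℤP.<-cmp 0ℤ (l' j)
  ... | tri< 0<l'j _ _ = ⊥-elim (no-positive-coincidence 1≤i i≤n 1≤j j≤m li≡l'j 0<l'j)
  ... | tri≈ _ 0≡l'j _ = sym 0≡l'j
  ... | tri> _ _ l'j<0 =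
    ⊥-elim (no-positive-coincidence (proj₁ (S.mirror-range 1≤i i≤n)) (proj₂ (S.mirror-range 1≤i i≤n))
                                    (proj₁ (S'.mirror-range 1≤j j≤m)) (proj₂ (S'.mirror-range 1≤j j≤m))
                                    mirrored (subst (0ℤ ℤ.<_) (sym (S'.mirror 1≤j j≤m)) (ℤP.neg-mono-< l'j<0)))
    where
    mirrored : l (suc n ∸ i) ≡ l' (suc m ∸ j)
    mirrored = trans (S.mirror 1≤i i≤n) (trans (cong -_ li≡l'j) (sym (S'.mirror 1≤j j≤m)))

module Position {n m} {w w' : ℤ} {l l' : ℕ → ℤ} {a : ℕ → ℕ}
                (Hl : InL0+ n w l) (Hl' : InL0+ m w' l') (PT : IsPositionTuple n l m l' a) where
  private
    module S  = L0⁺ {n} {w} {l} Hl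
    module S' = L0⁺ {m} {w'} {l'} Hl'

  Λ : ℕ → ℤ
  Λ = lam m w' l' a

  position-range : ∀ {j} → 1 ℕ.≤ j → j ℕ.≤ m → 1 ℕ.≤ a j × suc (a j) ℕ.≤ n
  position-range 1≤j j≤m with PT _ 1≤j j≤m
  ... | 1≤a , a≤n-1 , _ = 1≤a , below-pred 1≤a a≤n-1

  twoNu : ∀ {j} → 1 ℕ.≤ j → j ℕ.≤ m → + 2 * nu m w' l' j ≡ w' + l' j + + (2 ℕ.* j) - + 1 - + m
  twoNu {j} 1≤j j≤m = twice-half _ (Signed.∣⇒∣ᵤ (subst (+ 2 Signed.∣_) (sym numerator) even))
    where
    split : ∀ w L J M → w + L + + 2 * J - + 1 - M ≡ (w + L - (+ 1 + M)) + J * + 2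
    split = solve-∀
    numerator : w' + l' j + + (2 ℕ.* j) - + 1 - + m ≡ (w' + l' j - + suc m) + + j * + 2
    numerator = trans (cong (λ z → w' + l' j + z - + 1 - + m) (ℤP.pos-* 2 j)) (split w' (l' j) (+ j) (+ m))
    even : + 2 Signed.∣ ((w' + l' j - + suc m) + + j * + 2)
    even = Signed.∣m∣n⇒∣m+n (Signed.∣ᵤ⇒∣ {i = w' + l' j - + suc m} (proj₂ (proj₂ Hl') j 1≤j j≤m))
                            (Signed.∣n⇒∣m*n (+ j) Signed.∣-refl)

  twoLam : ∀ {j} → 1 ℕ.≤ j → j ℕ.≤ m → + 2 * Λ j ≡ w' + l' j + + 2 * + a j - + m - + 1
  twoLam {j} 1≤j j≤m = begin
    + 2 * (ν + + a j - + j)                                       ≡⟨ expand ν (+ a j) (+ j) ⟩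
    + 2 * ν + + 2 * + a j - + 2 * + j                             ≡⟨ cong (λ z → z + + 2 * + a j - + 2 * + j) (twoNu 1≤j j≤m) ⟩
    w' + l' j + + (2 ℕ.* j) - + 1 - + m + + 2 * + a j - + 2 * + j ≡⟨ cong (λ z → w' + l' j + z - + 1 - + m + + 2 * + a j - + 2 * + j)
                                                                          (ℤP.pos-* 2 j) ⟩
    w' + l' j + + 2 * + j - + 1 - + m + + 2 * + a j - + 2 * + j   ≡⟨ cancel w' (l' j) (+ j) (+ m) (+ a j) ⟩
    w' + l' j + + 2 * + a j - + m - + 1                           ∎
    where
    open ≡-Reasoning
    ν = nu m w' l' j
    expand : ∀ x A J → + 2 * (x + A - J) ≡ + 2 * x + + 2 * A - + 2 * J
    expand = solve-∀
    cancel : ∀ w L J M A → w + L + + 2 * J - + 1 - M + + 2 * A - + 2 * J ≡ w + L + + 2 * A - M - + 1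
    cancel = solve-∀

  shifted-step : ∀ {j} → 1 ℕ.≤ j → j ℕ.< m →
                 l' (suc j) + + 2 * + a (suc j) ℤ.< l' j + + 2 * + a j + + 2
  shifted-step {j} 1≤j j<m with a (suc j) ℕP.≤? a j
  ... | yes a'≤a = begin-strict
    l' (suc j) + + 2 * + a (suc j)    <⟨ ℤP.+-mono-<-≤ (proj₁ Hl' j 1≤j j<m) (ℤP.*-monoˡ-≤-nonNeg (+ 2) (ℤ.+≤+ a'≤a)) ⟩
    l' j + + 2 * + a j                ≤⟨ ℤP.i≤i+j _ (+ 2) ⟩
    l' j + + 2 * + a j + + 2          ∎
    where open ℤP.≤-Reasoning
  ... | no  a'≰a = begin-strict
    l' (suc j) + + 2 * + a (suc j)    <⟨ ℤP.+-monoˡ-< (+ 2 * + a (suc j)) (proj₁ (proj₂ (proj₂ (PT (suc j) (s≤s z≤n) j<m)))) ⟩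
    l (a (suc j)) + + 2 * + a (suc j) ≤⟨ S.shiftedAntitone (s≤s z≤n) (ℕP.≰⇒> a'≰a)
                                                           (ℕP.<⇒≤ (proj₂ (position-range (s≤s z≤n) j<m))) ⟩
    l (suc (a j)) + + 2 * + suc (a j) ≡⟨ shift (l (suc (a j))) (+ a j) ⟩
    l (suc (a j)) + + 2 * + a j + + 2 ≤⟨ ℤP.+-monoˡ-≤ (+ 2) (ℤP.+-monoˡ-≤ (+ 2 * + a j)
                                                                        (proj₂ (proj₂ (proj₂ (PT j 1≤j (ℕP.<⇒≤ j<m)))))) ⟩
    l' j + + 2 * + a j + + 2          ∎
    where
    open ℤP.≤-Reasoning
    shift : ∀ x A → x + + 2 * (+ 1 + A) ≡ x + + 2 * A + + 2
    shift = solve-∀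

  -- Dominance: 2λ_{j+1} < 2(λ_j + 1), so the integer λ_{j+1} is at most λ_j.
  dominant : ∀ {j} → 1 ℕ.≤ j → j ℕ.< m → Λ (suc j) ℤ.≤ Λ j
  dominant {j} 1≤j j<m =
    subst (Λ (suc j) ℤ.≤_) (ℤP.pred-suc (Λ j)) (ℤP.i<j⇒i≤pred[j] (ℤP.*-cancelˡ-<-nonNeg (+ 2) doubled))
    where
    open ℤP.≤-Reasoning
    regroup : ∀ w L A M → w + L + A - M - + 1 ≡ (L + A) + (w - M - + 1)
    regroup = solve-∀
    regroup' : ∀ w L A M → (L + A + + 2) + (w - M - + 1) ≡ (w + L + A - M - + 1) + + 2
    regroup' = solve-∀
    successor : ∀ x → + 2 * x + + 2 ≡ + 2 * (+ 1 + x)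
    successor = solve-∀
    doubled : + 2 * Λ (suc j) ℤ.< + 2 * ℤ.suc (Λ j)
    doubled = begin-strict
      + 2 * Λ (suc j)                                     ≡⟨ twoLam (s≤s z≤n) j<m ⟩
      w' + l' (suc j) + + 2 * + a (suc j) - + m - + 1     ≡⟨ regroup w' (l' (suc j)) _ (+ m) ⟩
      (l' (suc j) + + 2 * + a (suc j)) + (w' - + m - + 1) <⟨ ℤP.+-monoˡ-< (w' - + m - + 1) (shifted-step 1≤j j<m) ⟩
      (l' j + + 2 * + a j + + 2) + (w' - + m - + 1)       ≡⟨ regroup' w' (l' j) _ (+ m) ⟩
      (w' + l' j + + 2 * + a j - + m - + 1) + + 2         ≡⟨ cong (_+ + 2) (twoLam 1≤j (ℕP.<⇒≤ j<m)) ⟨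
      + 2 * Λ j + + 2                                     ≡⟨ successor (Λ j) ⟩
      + 2 * ℤ.suc (Λ j)                                   ∎

  complementary : ∀ {δ δ' T} → Critical n m (tauW n w l δ m w' l' δ') T →
                  ∀ {j} → 1 ℕ.≤ j → j ℕ.≤ m →
                  a j ℕ.+ a (suc m ∸ j) ≡ n ⊎ (2 ℕ.* j ≡ suc m × 2 ℕ.* suc (a j) ≡ suc n)
  complementary crit {j} 1≤j j≤m =
    ⊎-map sum-is-n exceptional (S.bracket 1≤a a<n 1≤q q<n (proj₂ (proj₂ (proj₂ (PT j 1≤j j≤m))))
                                          (proj₁ (proj₂ (proj₂ (PT j 1≤j j≤m)))) below above)
    where
    j' = suc m ∸ j
    j'-range = S'.mirror-range 1≤j j≤m
    a' = a j'
    1≤a  = proj₁ (position-range 1≤j j≤m)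
    a<n  = proj₂ (position-range 1≤j j≤m)
    1≤a' = proj₁ (position-range (proj₁ j'-range) (proj₂ j'-range))
    a'<n = proj₂ (position-range (proj₁ j'-range) (proj₂ j'-range))
    a'≤n = ℕP.<⇒≤ a'<n
    -- negating the bracket of l'_{j'} = -l'_j gives l_{q+1} < l'_j ≤ l_q for q = n - a'
    q = n ∸ a'
    suc-q : suc n ∸ a' ≡ suc q
    suc-q = ℕP.+-∸-assoc 1 a'≤n
    1≤q : 1 ℕ.≤ q
    1≤q = proj₁ (S.mirror-range {suc a'} (s≤s z≤n) a'<n)
    q<n : suc q ℕ.≤ n
    q<n = subst (ℕ._≤ n) suc-q (proj₂ (S.mirror-range 1≤a' a'≤n))
    -l'j'≡l'j : - l' j' ≡ l' j
    -l'j'≡l'j = trans (cong -_ (S'.mirror 1≤j j≤m)) (ℤP.neg-involutive (l' j))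
    below : l (suc q) ℤ.< l' j
    below = subst (λ k → l k ℤ.< l' j) suc-q
              (subst₂ ℤ._<_ (sym (S.mirror 1≤a' a'≤n)) -l'j'≡l'j
                 (ℤP.neg-mono-< (proj₁ (proj₂ (proj₂ (PT j' (proj₁ j'-range) (proj₂ j'-range)))))))
    above : l' j ℤ.≤ l q
    above = subst₂ ℤ._≤_ -l'j'≡l'j (sym (S.mirror {suc a'} (s≤s z≤n) a'<n))
              (ℤP.neg-mono-≤ (proj₂ (proj₂ (proj₂ (PT j' (proj₁ j'-range) (proj₂ j'-range))))))
    sum-is-n : a j ≡ q → a j ℕ.+ a' ≡ n
    sum-is-n a≡q = trans (cong (ℕ._+ a') a≡q) (ℕP.m∸n+n≡m a'≤n)
    exceptional : l' j ≡ l (suc (a j)) → 2 ℕ.* j ≡ suc m × 2 ℕ.* suc (a j) ≡ suc n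
    exceptional l'j≡l = S'.zero⇒middle 1≤j j≤m l'j≡0 , S.zero⇒middle (s≤s z≤n) a<n (trans (sym l'j≡l) l'j≡0)
      where l'j≡0 = Coincidence.coincidence⇒zero Hl Hl' crit (s≤s z≤n) a<n 1≤j j≤m (sym l'j≡l)

  paired-sum : ∀ {j} → 1 ℕ.≤ j → j ℕ.≤ m → a j ℕ.+ a (suc m ∸ j) ≡ n →
               Λ j + Λ (suc m ∸ j) ≡ w' + + n - + m - + 1
  paired-sum {j} 1≤j j≤m a+a'≡n = ℤP.*-cancelˡ-≡ (+ 2) _ _ (begin
    + 2 * (Λ j + Λ j')                                          ≡⟨ ℤP.*-distribˡ-+ (+ 2) (Λ j) (Λ j') ⟩
    + 2 * Λ j + + 2 * Λ j'                                      ≡⟨ cong₂ _+_ (twoLam 1≤j j≤m) (twoLam (proj₁ j'-range) (proj₂ j'-range)) ⟩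
    (w' + l' j + + 2 * + a j - + m - + 1) + (w' + l' j' + + 2 * + a j' - + m - + 1)
                                                                ≡⟨ regroup w' (l' j) (l' j') (+ a j) (+ a j') (+ m) ⟩
    + 2 * (w' + (+ a j + + a j') - + m - + 1) + (l' j + l' j')  ≡⟨ cong₂ (λ A L → + 2 * (w' + A - + m - + 1) + L)
                                                                        (trans (sym (ℤP.pos-+ (a j) (a j'))) (cong +_ a+a'≡n))
                                                                        (proj₁ (proj₂ Hl') j 1≤j j≤m) ⟩
    + 2 * (w' + + n - + m - + 1) + 0ℤ                           ≡⟨ ℤP.+-identityʳ _ ⟩
    + 2 * (w' + + n - + m - + 1)                                ∎)
    where
    open ≡-Reasoning
    j' = suc m ∸ j
    j'-range = S'.mirror-range 1≤j j≤m
    regroup : ∀ w L L' A A' M → (w + L + + 2 * A - M - + 1) + (w + L' + + 2 * A' - M - + 1)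
                                ≡ + 2 * (w + (A + A') - M - + 1) + (L + L')
    regroup = solve-∀

  -- At the middle indices l'_j = 0 and 2a_j = n - 1.
  middle-value : ∀ {j} → 1 ℕ.≤ j → j ℕ.≤ m → 2 ℕ.* j ≡ suc m → 2 ℕ.* suc (a j) ≡ suc n →
                 + 2 * Λ j ≡ w' + + n - + m - + 2
  middle-value {j} 1≤j j≤m 2j≡m+1 2a+2≡n+1 = begin
    + 2 * Λ j                                ≡⟨ twoLam 1≤j j≤m ⟩
    w' + l' j + + 2 * + a j - + m - + 1      ≡⟨ cong (λ L → w' + L + + 2 * + a j - + m - + 1) (S'.middle⇒zero 1≤j j≤m 2j≡m+1) ⟩
    w' + 0ℤ + + 2 * + a j - + m - + 1        ≡⟨ regroup w' (+ 2 * + a j) (+ m) ⟩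
    w' + (+ 1 + + 2 * + a j) - + m - + 2     ≡⟨ cong (λ N → w' + N - + m - + 2) n≡1+2a ⟨
    w' + + n - + m - + 2                     ∎
    where
    open ≡-Reasoning
    regroup : ∀ w A M → w + 0ℤ + A - M - + 1 ≡ w + (+ 1 + A) - M - + 2
    regroup = solve-∀
    n≡1+2a : + n ≡ + 1 + + 2 * + a j
    n≡1+2a = trans (cong +_ (sym (ℕP.suc-injective (trans (sym (ℕP.*-suc 2 (a j))) 2a+2≡n+1))))
                   (cong (λ z → + 1 + z) (ℤP.pos-* 2 (a j)))

  symmetry-or-centre : ∀ {δ δ' T} → Critical n m (tauW n w l δ m w' l' δ') T →
                       ∀ {j} → 1 ℕ.≤ j → j ℕ.≤ m →
                       Λ j + Λ (suc m ∸ j) ≡ w' + + n - + m - + 1 ⊎ (2 ℕ.* j ≡ suc m × 2 ℕ.* suc (a j) ≡ suc n)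
  symmetry-or-centre crit 1≤j j≤m = ⊎-map (paired-sum 1≤j j≤m) (λ centre → centre) (complementary crit 1≤j j≤m)

  -- For n, m odd the middle index c = (m+1)/2 cannot have 2a_c = n, so it is exceptional.
  centre-value : ∀ {δ δ' T} → Critical n m (tauW n w l δ m w' l' δ') T →
                 n % 2 ≡ 1 → m % 2 ≡ 1 → + 2 * Λ (suc m / 2) ≡ w' + + n - + m - + 2
  centre-value crit n-odd m-odd =
    [ (λ a+a≡n → ⊥-elim (odd⇒≢twice (a c) n-odd (subst (λ k → a c ℕ.+ a k ≡ n) (middle-mirror c 2c≡m+1) a+a≡n)))
    , (λ centre → middle-value 1≤c c≤m 2c≡m+1 (proj₂ centre)) ] (complementary crit 1≤c c≤m)
    where
    c = suc m / 2
    2c≡m+1 = odd⇒middle m-odd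
    1≤c = proj₁ (middle-range c 2c≡m+1)
    c≤m = proj₂ (middle-range c 2c≡m+1)

proposition3p1 :
    (n m : ℕ) → 1 ℕ.≤ n → 1 ℕ.≤ m →
    (w : ℤ) (l : ℕ → ℤ) → InL0+ n w l →
    (w' : ℤ) (l' : ℕ → ℤ) → InL0+ m w' l' →
    (δ δ' : ℕ) → δ ℕ.≤ 1 → δ' ℕ.≤ 1 →
    (∃ λ T → Critical n m (tauW n w l δ m w' l' δ') T) →
    l' 1 ℤ.< l 1 →
    (a : ℕ → ℕ) → IsPositionTuple n l m l' a →
      (∀ j → 1 ℕ.≤ j → j ℕ.< m → lam m w' l' a (suc j) ℤ.≤ lam m w' l' a j)
    × (∀ j → 1 ℕ.≤ j → j ℕ.≤ m → 2 ℕ.* j ≢ suc m →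
         lam m w' l' a j + lam m w' l' a (suc m ∸ j) ≡ w' + + n - + m - + 1)
    × (n % 2 ≡ 1 → m % 2 ≡ 1 →
         + 2 * lam m w' l' a (suc m / 2) ≡ w' + + n - + m - + 2)
    × (¬ (n % 2 ≡ 1 × m % 2 ≡ 1) →
         ∀ j → 1 ℕ.≤ j → j ℕ.≤ m →
           lam m w' l' a j + lam m w' l' a (suc m ∸ j) ≡ w' + + n - + m - + 1)
proposition3p1 n m _ _ w l Hl w' l' Hl' δ δ' _ _ (T , crit) _ a PT =
    (λ j 1≤j j<m → dominant 1≤j j<m)
  , (λ j 1≤j j≤m 2j≢m+1 →
       [ (λ symmetric → symmetric) , (λ centre → ⊥-elim (2j≢m+1 (proj₁ centre))) ]
         (symmetry-or-centre crit 1≤j j≤m))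
  , centre-value crit
  , (λ not-both-odd j 1≤j j≤m →
       [ (λ symmetric → symmetric)
       , (λ centre → ⊥-elim (not-both-odd (twice≡suc⇒odd (suc (a j)) (proj₂ centre) , twice≡suc⇒odd j (proj₁ centre)))) ]
         (symmetry-or-centre crit 1≤j j≤m))
  where open Position {n} {m} {w} {w'} {l} {l'} {a} Hl Hl' PT
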